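{- For $1\le m\le n$, $$m\,E_m\!\left[\frac1\ell\right]+\sum_{j=1}^{m-1}E_m\!\left[\frac{\tau_j}{\ell}\right]=1.$$
   Context: Let $\mathbf X=\{X_1,\dots,X_n\}$ with uniform probability. For $1\le m\le n$, $\mathcal X_m$ is the set of finite sequences $\chi=(\chi_1,\dots,\chi_\ell)$ in $\mathbf X$ with $\{\chi_1,\dots,\chi_\ell\}$ of cardinality exactly $m$ and $\chi_\ell\ne\chi_j$ for $j<\ell$, with length $\ell=\ell(\chi)$ and probability $\mu(\chi)=n^{ -\ell(\chi)}$; $E_m$ is expectation on $\mathcal X_m$. For $0\le i\le m$, $t_i(\chi)$ is the least $t$ with $|\{\chi_1,\dots,\chi_t\}|=i$ ($t_0=0$), and for $1\le j\le m-1$, $\tau_j(\chi)=t_{j+1}(\chi)-t_j(\chi)-1$. -}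

module Defs where

open import Data.Bool using (Bool; true; false; _∧_; not)
open import Data.Nat as ℕ using (ℕ; zero; suc; _∸_; _^_)
open import Data.Nat.Properties using (m^n≢0)
open import Data.Fin using (Fin)
open import Data.Fin.Properties using () renaming (_≟_ to _≟F_)
open import Data.List using (List; allFin; []; _∷_; length; take; concatMap; map; filterᵇ; takeWhileᵇ; upTo; deduplicate; reverse; foldr)
open import Data.Bool.ListAction using (any)
open import Data.Integer using (+_)
open import Data.Rational using (ℚ; 0ℚ; _/_; _+_; _*_)
open import Relation.Nullary using (does)

seqs : (n ℓ : ℕ) → List (List (Fin n))
seqs n zero    = [] ∷ []
seqs n (suc ℓ) = concatMap (λ x → map (x ∷_) (seqs n ℓ)) (allFin n)

card : ∀ {n} → List (Fin n) → ℕ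
card xs = length (deduplicate _≟F_ xs)

-- the last entry differs from all earlier ones (false for the empty sequence)
lastFresh : ∀ {n} → List (Fin n) → Bool
lastFresh xs with reverse xs
... | []       = false
... | x ∷ rest = not (any (λ y → does (x ≟F y)) rest)

inX : ∀ {n} → ℕ → List (Fin n) → Bool
inX m χ = does (card χ ℕ.≟ m) ∧ lastFresh χ

-- t_i(χ): least t with |{χ_1,…,χ_t}| = i
tt : ∀ {n} → ℕ → List (Fin n) → ℕ
tt i χ = length (takeWhileᵇ (λ t → not (does (card (take t χ) ℕ.≟ i))) (upTo (suc (length χ))))

τ : ∀ {n} → ℕ → List (Fin n) → ℕ
τ j χ = tt (suc j) χ ∸ tt j χ ∸ 1

-- n^{-ℓ} (n ≥ 1 in all uses; value 0 for n = 0 is irrelevant)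
invPow : ℕ → ℕ → ℚ
invPow zero     ℓ = 0ℚ
invPow (suc n') ℓ = _/_ (+ 1) (suc n' ^ ℓ) {{m^n≢0 (suc n') ℓ}}

sumℚ : List ℚ → ℚ
sumℚ = foldr _+_ 0ℚ

-- contribution of sequences of length ℓ to E_m[f/ℓ] : Σ_{χ ∈ 𝒳_m, ℓ(χ)=ℓ} n^{-ℓ} f(χ)/ℓ
levelE : (n m : ℕ) → (List (Fin n) → ℕ) → ℕ → ℚ
levelE n m f zero    = 0ℚ
levelE n m f (suc k) =
  sumℚ (map (λ χ → ((+ f χ) / suc k) * invPow n (suc k)) (filterᵇ (inX m) (seqs n (suc k))))

partialE : (n m : ℕ) → (List (Fin n) → ℕ) → ℕ → ℚ
partialE n m f L = sumℚ (map (levelE n m f) (upTo (suc L)))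

sumRange : ℕ → ℕ → (ℕ → ℚ) → ℚ
sumRange a b g = sumℚ (map (λ i → g (a ℕ.+ i)) (upTo (suc b ∸ a)))

lhsPartial : (n m L : ℕ) → ℚ
lhsPartial n m L =
  ((+ m) / 1) * partialE n m (λ _ → 1) L + sumRange 1 (m ∸ 1) (λ j → partialE n m (τ j) L)

module Submission where

-- Every χ ∈ 𝒳_m satisfies the deterministic identity
--   m + Σ_{j=1}^{m-1} τ_j(χ) = ℓ(χ),                                          (1)
-- because t₁ = 1, t_m = ℓ(χ) and the τ_j telescope.  Dividing by ℓ(χ), the
-- left-hand side of the theorem is the total mass Σ_{χ ∈ 𝒳_m} n^{-ℓ(χ)}.
-- With B_L the number of sequences of length L with fewer than m distinct
-- entries and c_ℓ = |{χ ∈ 𝒳_m : ℓ(χ) = ℓ}|, appending a letter gives the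
-- counting recursion  B_{L+1} + c_{L+1} = n B_L,  so the mass up to length L
-- equals 1 − B_L n^{-L}.  A union bound over the missing letter gives
-- B_L ≤ n (n-1)^L, and a Bernoulli-type inequality turns this into an
-- explicit length beyond which B_L n^{-L} < ε.

open import Defs

open import Algebra.Structures using (IsCommutativeSemiring; IsCommutativeRing)
open import Data.Bool using (Bool; true; false; _∨_; not; T; T?; if_then_else_)
import Data.Bool.Properties as BoolP
open import Data.Bool.ListAction using (any)
open import Data.Empty using (⊥-elim)
open import Data.Fin using (Fin; zero; suc)
open import Data.Fin.Properties using (injective⇒≤) renaming (_≟_ to _≟F_)
open import Data.Integer as ℤ using (+_; +[1+_]; -[1+_])
import Data.Integer.Properties as ℤP
open import Data.List using (List; []; _∷_; _++_; _∷ʳ_; [_]; length; map; concatMap; filter; filterᵇ; take; takeWhileᵇ; allFin; tabulate; upTo; applyUpTo; reverse; deduplicate; foldr; initLast; _∷ʳ′_; lookup)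
import Data.List.Properties as ListP
open import Data.List.Membership.Propositional using (_∈_)
open import Data.List.Membership.Propositional.Properties using (∈-allFin; ∈-deduplicate⁺)
open import Data.List.Relation.Unary.All as All using (All; []; _∷_)
import Data.List.Relation.Unary.All.Properties as AllP
open import Data.List.Relation.Unary.Any as Any using (here; there)
open import Data.List.Relation.Unary.Any.Properties using (lookup-index)
open import Data.Nat as ℕ using (ℕ; zero; suc; _∸_; _^_; _≤_; _<_; z≤n; s≤s; _<ᵇ_)
open import Data.Nat.Coprimality using (Coprime)
import Data.Nat.Properties as ℕP
import Data.Nat.Solver as ℕSolver
open import Data.Product using (∃-syntax; _×_; _,_)
open import Data.Rational as ℚ using (ℚ; 0ℚ; 1ℚ; _/_; _-_; ∣_∣; mkℚ; toℚᵘ)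
import Data.Rational.Properties as ℚP
open import Data.Rational.Solver using (module +-*-Solver)
open import Data.Rational.Unnormalised as ℚᵘ using (mkℚᵘ; *≡*) renaming (_≃_ to _≃ᵘ_)
import Data.Rational.Unnormalised.Properties as ℚᵘP
open import Data.Sum using (_⊎_; inj₁; inj₂)
open import Function using (_∘_; id)
open import Function.Bundles using (Equivalence)
open import Relation.Nullary using (Dec; does; yes; no; ¬?)
open import Relation.Nullary.Decidable using (dec-true; dec-false)
open import Relation.Binary.PropositionalEquality hiding ([_])

module ListSums {A : Set} {_+_ _*_ : A → A → A} {0# 1# : A}
                (isCS : IsCommutativeSemiring _≡_ _+_ _*_ 0# 1#) where

  open IsCommutativeSemiring isCS using (+-assoc; +-comm; +-identityˡ; +-identityʳ; *-comm; distribˡ; zeroʳ)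

  sumOf : {B : Set} → (B → A) → List B → A
  sumOf f xs = foldr _+_ 0# (map f xs)

  sumOf-++ : {B : Set} (f : B → A) (xs ys : List B) → sumOf f (xs ++ ys) ≡ sumOf f xs + sumOf f ys
  sumOf-++ f []       ys = sym (+-identityˡ _)
  sumOf-++ f (x ∷ xs) ys = trans (cong (_+_ (f x)) (sumOf-++ f xs ys)) (sym (+-assoc _ _ _))

  sumOf-+ : {B : Set} (f g : B → A) (xs : List B) → sumOf (λ x → f x + g x) xs ≡ sumOf f xs + sumOf g xs
  sumOf-+ f g []       = sym (+-identityˡ 0#)
  sumOf-+ f g (x ∷ xs) = begin
    (f x + g x) + sumOf (λ x → f x + g x) xs ≡⟨ cong (_+_ (f x + g x)) (sumOf-+ f g xs) ⟩
    (f x + g x) + (F + G)                    ≡⟨ +-assoc (f x) (g x) (F + G) ⟩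
    f x + (g x + (F + G))                    ≡⟨ cong (_+_ (f x)) (sym (+-assoc (g x) F G)) ⟩
    f x + ((g x + F) + G)                    ≡⟨ cong (λ y → f x + (y + G)) (+-comm (g x) F) ⟩
    f x + ((F + g x) + G)                    ≡⟨ cong (_+_ (f x)) (+-assoc F (g x) G) ⟩
    f x + (F + (g x + G))                    ≡⟨ sym (+-assoc (f x) F (g x + G)) ⟩
    (f x + F) + (g x + G)                    ∎
    where
    open ≡-Reasoning
    F : A
    F = sumOf f xs
    G : A
    G = sumOf g xs

  sumOf-zero : {B : Set} (xs : List B) → sumOf (λ _ → 0#) xs ≡ 0#
  sumOf-zero []       = refl
  sumOf-zero (x ∷ xs) = trans (+-identityˡ _) (sumOf-zero xs)

  sumOf-cong : {B : Set} {f g : B → A} → (∀ x → f x ≡ g x) → ∀ xs → sumOf f xs ≡ sumOf g xs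
  sumOf-cong f≗g xs = cong (foldr _+_ 0#) (ListP.map-cong f≗g xs)

  sumOf-congAll : {B : Set} {P : B → Set} {f g : B → A} → (∀ {x} → P x → f x ≡ g x) →
                  ∀ {xs} → All P xs → sumOf f xs ≡ sumOf g xs
  sumOf-congAll f≈g []         = refl
  sumOf-congAll f≈g (px ∷ pxs) = cong₂ _+_ (f≈g px) (sumOf-congAll f≈g pxs)

  sumOf-map : {B C : Set} (f : C → A) (h : B → C) (xs : List B) → sumOf f (map h xs) ≡ sumOf (f ∘ h) xs
  sumOf-map f h xs = cong (foldr _+_ 0#) (sym (ListP.map-∘ xs))

  sumOf-concatMap : {B C : Set} (f : C → A) (h : B → List C) (xs : List B) →
                    sumOf f (concatMap h xs) ≡ sumOf (λ x → sumOf f (h x)) xs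
  sumOf-concatMap f h []       = refl
  sumOf-concatMap f h (x ∷ xs) =
    trans (sumOf-++ f (h x) (concatMap h xs)) (cong (_+_ (sumOf f (h x))) (sumOf-concatMap f h xs))

  sumOf-swap : {B C : Set} (f : B → C → A) (xs : List B) (ys : List C) →
               sumOf (λ x → sumOf (f x) ys) xs ≡ sumOf (λ y → sumOf (λ x → f x y) xs) ys
  sumOf-swap f []       ys = sym (sumOf-zero ys)
  sumOf-swap f (x ∷ xs) ys =
    trans (cong (_+_ (sumOf (f x) ys)) (sumOf-swap f xs ys)) (sym (sumOf-+ (f x) _ ys))

  sumOf-*ˡ : {B : Set} (c : A) (f : B → A) (xs : List B) → c * sumOf f xs ≡ sumOf (λ x → c * f x) xs
  sumOf-*ˡ c f []       = zeroʳ c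
  sumOf-*ˡ c f (x ∷ xs) = trans (distribˡ c (f x) _) (cong (_+_ (c * f x)) (sumOf-*ˡ c f xs))

  sumOf-*ʳ : {B : Set} (c : A) (f : B → A) (xs : List B) → sumOf f xs * c ≡ sumOf (λ x → f x * c) xs
  sumOf-*ʳ c f xs =
    trans (*-comm (sumOf f xs) c) (trans (sumOf-*ˡ c f xs) (sumOf-cong (λ x → *-comm c (f x)) xs))

  sumOf-allFin-suc : ∀ {n} (f : Fin (suc n) → A) → sumOf f (allFin (suc n)) ≡ f zero + sumOf (f ∘ suc) (allFin n)
  sumOf-allFin-suc {n} f = cong (λ ys → f zero + foldr _+_ 0# ys)
    (trans (ListP.map-tabulate suc f) (sym (ListP.map-tabulate id (f ∘ suc))))

  sumOf-seqs-cons : ∀ {n} ℓ (F : List (Fin n) → A) →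
                    sumOf F (seqs n (suc ℓ)) ≡ sumOf (λ x → sumOf (λ χ → F (x ∷ χ)) (seqs n ℓ)) (allFin n)
  sumOf-seqs-cons {n} ℓ F = trans (sumOf-concatMap F (λ x → map (x ∷_) (seqs n ℓ)) (allFin n))
                                  (sumOf-cong (λ x → sumOf-map F (x ∷_) (seqs n ℓ)) (allFin n))

  sumOf-seqs-snoc : ∀ {n} ℓ (F : List (Fin n) → A) →
                    sumOf F (seqs n (suc ℓ)) ≡ sumOf (λ ψ → sumOf (λ z → F (ψ ∷ʳ z)) (allFin n)) (seqs n ℓ)
  sumOf-seqs-snoc {n} zero F = begin
    sumOf F (seqs n 1)                        ≡⟨ sumOf-seqs-cons 0 F ⟩
    sumOf (λ x → F (x ∷ []) + 0#) (allFin n)  ≡⟨ sumOf-cong (λ x → +-identityʳ (F (x ∷ []))) (allFin n) ⟩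
    sumOf (λ z → F (z ∷ [])) (allFin n)       ≡⟨ sym (+-identityʳ _) ⟩
    sumOf (λ z → F (z ∷ [])) (allFin n) + 0#  ∎
    where open ≡-Reasoning
  sumOf-seqs-snoc {n} (suc ℓ) F = begin
    sumOf F (seqs n (suc (suc ℓ)))
      ≡⟨ sumOf-seqs-cons (suc ℓ) F ⟩
    sumOf (λ x → sumOf (λ χ → F (x ∷ χ)) (seqs n (suc ℓ))) (allFin n)
      ≡⟨ sumOf-cong (λ x → sumOf-seqs-snoc ℓ (F ∘ (x ∷_))) (allFin n) ⟩
    sumOf (λ x → sumOf (λ ψ → G (x ∷ ψ)) (seqs n ℓ)) (allFin n)
      ≡⟨ sym (sumOf-seqs-cons ℓ G) ⟩
    sumOf G (seqs n (suc ℓ)) ∎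
    where
    open ≡-Reasoning
    G : List (Fin n) → A
    G ψ = sumOf (λ z → F (ψ ∷ʳ z)) (allFin n)

  sumOf-upTo-suc : (f : ℕ → A) (L : ℕ) → sumOf f (upTo (suc L)) ≡ sumOf f (upTo L) + f L
  sumOf-upTo-suc f L = begin
    sumOf f (upTo (suc L))         ≡⟨ cong (sumOf f) (sym (ListP.upTo-∷ʳ L)) ⟩
    sumOf f (upTo L ++ [ L ])      ≡⟨ sumOf-++ f (upTo L) [ L ] ⟩
    sumOf f (upTo L) + (f L + 0#)  ≡⟨ cong (_+_ (sumOf f (upTo L))) (+-identityʳ (f L)) ⟩
    sumOf f (upTo L) + f L         ∎
    where open ≡-Reasoning

module ℕΣ = ListSums ℕP.+-*-isCommutativeSemiring
module ℚΣ = ListSums (IsCommutativeRing.isCommutativeSemiring ℚP.+-*-isCommutativeRing)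
open ℕΣ using () renaming (sumOf to sumℕ)
open ℚΣ using () renaming (sumOf to sumQ)

-- Natural numbers and unit fractions inside ℚ.  All identities are checked
-- on unnormalised representatives, where they are integer identities.
ι : ℕ → ℚ
ι a = (+ a) / 1

toℚᵘ-/ : ∀ a k .{{_ : ℕ.NonZero k}} → toℚᵘ ((+ a) / k) ≃ᵘ mkℚᵘ (+ a) (ℕ.pred k)
toℚᵘ-/ a (suc d) = ℚP.toℚᵘ-fromℚᵘ (mkℚᵘ (+ a) d)

module _ where
  open ℚᵘP.≃-Reasoning

  ι-+ : ∀ a b → ι (a ℕ.+ b) ≡ ι a ℚ.+ ι b
  ι-+ a b = ℚP.toℚᵘ-injective (begin
    toℚᵘ (ι (a ℕ.+ b))                ≈⟨ toℚᵘ-/ (a ℕ.+ b) 1 ⟩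
    mkℚᵘ (+ (a ℕ.+ b)) 0              ≈⟨ *≡* integers ⟩
    mkℚᵘ (+ a) 0 ℚᵘ.+ mkℚᵘ (+ b) 0    ≈⟨ ℚᵘP.≃-sym (ℚᵘP.+-cong (toℚᵘ-/ a 1) (toℚᵘ-/ b 1)) ⟩
    toℚᵘ (ι a) ℚᵘ.+ toℚᵘ (ι b)        ≈⟨ ℚᵘP.≃-sym (ℚP.toℚᵘ-homo-+ (ι a) (ι b)) ⟩
    toℚᵘ (ι a ℚ.+ ι b)                ∎)
    where
    integers : + (a ℕ.+ b) ℤ.* + 1 ≡ (+ a ℤ.* + 1 ℤ.+ + b ℤ.* + 1) ℤ.* + 1
    integers rewrite ℤP.*-identityʳ (+ (a ℕ.+ b)) | ℤP.*-identityʳ (+ a) | ℤP.*-identityʳ (+ b)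
                   | ℤP.*-identityʳ (+ a ℤ.+ + b) = ℤP.pos-+ a b

  ι-* : ∀ a b → ι (a ℕ.* b) ≡ ι a ℚ.* ι b
  ι-* a b = ℚP.toℚᵘ-injective (begin
    toℚᵘ (ι (a ℕ.* b))                ≈⟨ toℚᵘ-/ (a ℕ.* b) 1 ⟩
    mkℚᵘ (+ (a ℕ.* b)) 0              ≈⟨ *≡* integers ⟩
    mkℚᵘ (+ a) 0 ℚᵘ.* mkℚᵘ (+ b) 0    ≈⟨ ℚᵘP.≃-sym (ℚᵘP.*-cong (toℚᵘ-/ a 1) (toℚᵘ-/ b 1)) ⟩
    toℚᵘ (ι a) ℚᵘ.* toℚᵘ (ι b)        ≈⟨ ℚᵘP.≃-sym (ℚP.toℚᵘ-homo-* (ι a) (ι b)) ⟩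
    toℚᵘ (ι a ℚ.* ι b)                ∎)
    where
    integers : + (a ℕ.* b) ℤ.* + 1 ≡ (+ a ℤ.* + b) ℤ.* + 1
    integers rewrite ℤP.*-identityʳ (+ (a ℕ.* b)) | ℤP.*-identityʳ (+ a ℤ.* + b) = ℤP.pos-* a b

  /-split : ∀ a k .{{_ : ℕ.NonZero k}} → (+ a) / k ≡ ι a ℚ.* ((+ 1) / k)
  /-split a k@(suc d) = ℚP.toℚᵘ-injective (begin
    toℚᵘ ((+ a) / k)                       ≈⟨ toℚᵘ-/ a k ⟩
    mkℚᵘ (+ a) d                           ≈⟨ *≡* integers ⟩
    mkℚᵘ (+ a) 0 ℚᵘ.* mkℚᵘ (+ 1) d         ≈⟨ ℚᵘP.≃-sym (ℚᵘP.*-cong (toℚᵘ-/ a 1) (toℚᵘ-/ 1 k)) ⟩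
    toℚᵘ (ι a) ℚᵘ.* toℚᵘ ((+ 1) / k)       ≈⟨ ℚᵘP.≃-sym (ℚP.toℚᵘ-homo-* (ι a) ((+ 1) / k)) ⟩
    toℚᵘ (ι a ℚ.* ((+ 1) / k))             ∎)
    where
    integers : + a ℤ.* + suc (d ℕ.+ 0) ≡ (+ a ℤ.* + 1) ℤ.* + k
    integers rewrite ℕP.+-identityʳ d | ℤP.*-identityʳ (+ a) = refl

  /-inverse : ∀ k .{{_ : ℕ.NonZero k}} → ((+ 1) / k) ℚ.* ι k ≡ 1ℚ
  /-inverse k@(suc d) = ℚP.toℚᵘ-injective (begin
    toℚᵘ (((+ 1) / k) ℚ.* ι k)             ≈⟨ ℚP.toℚᵘ-homo-* ((+ 1) / k) (ι k) ⟩
    toℚᵘ ((+ 1) / k) ℚᵘ.* toℚᵘ (ι k)       ≈⟨ ℚᵘP.*-cong (toℚᵘ-/ 1 k) (toℚᵘ-/ k 1) ⟩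
    mkℚᵘ (+ 1) d ℚᵘ.* mkℚᵘ (+ k) 0         ≈⟨ *≡* integers ⟩
    mkℚᵘ (+ 1) 0                           ≈⟨ ℚᵘP.≃-sym (toℚᵘ-/ 1 1) ⟩
    toℚᵘ 1ℚ                                ∎)
    where
    integers : (+ 1 ℤ.* + k) ℤ.* + 1 ≡ + 1 ℤ.* + suc (d ℕ.* 1)
    integers = trans (ℤP.*-identityʳ (+ 1 ℤ.* + k)) (trans (ℤP.*-identityˡ (+ k))
                 (trans (cong (λ x → + suc x) (sym (ℕP.*-identityʳ d))) (sym (ℤP.*-identityˡ _))))

ι-sum : {B : Set} (f : B → ℕ) (xs : List B) → sumQ (ι ∘ f) xs ≡ ι (sumℕ f xs)
ι-sum f []       = refl
ι-sum f (x ∷ xs) = trans (cong (ℚ._+_ (ι (f x))) (ι-sum f xs)) (sym (ι-+ (f x) _))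

sumQ-const : {B : Set} (c : ℚ) (xs : List B) → sumQ (λ _ → c) xs ≡ ι (length xs) ℚ.* c
sumQ-const c []       = sym (ℚP.*-zeroˡ c)
sumQ-const c (x ∷ xs) = begin
  c ℚ.+ sumQ (λ _ → c) xs               ≡⟨ cong (ℚ._+_ c) (sumQ-const c xs) ⟩
  c ℚ.+ ι (length xs) ℚ.* c             ≡⟨ cong (ℚ._+ ι (length xs) ℚ.* c) (sym (ℚP.*-identityˡ c)) ⟩
  1ℚ ℚ.* c ℚ.+ ι (length xs) ℚ.* c      ≡⟨ sym (ℚP.*-distribʳ-+ c 1ℚ (ι (length xs))) ⟩
  (1ℚ ℚ.+ ι (length xs)) ℚ.* c          ≡⟨ cong (ℚ._* c) (sym (ι-+ 1 (length xs))) ⟩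
  ι (suc (length xs)) ℚ.* c             ∎
  where open ≡-Reasoning

𝟙 : Bool → ℕ
𝟙 true  = 1
𝟙 false = 0

count-filter : {B : Set} (p : B → Bool) (xs : List B) → length (filterᵇ p xs) ≡ sumℕ (𝟙 ∘ p) xs
count-filter p []       = refl
count-filter p (x ∷ xs) with p x
... | true  = cong suc (count-filter p xs)
... | false = count-filter p xs

sumℕ-const : {B : Set} (c : ℕ) (xs : List B) → sumℕ (λ _ → c) xs ≡ length xs ℕ.* c
sumℕ-const c []       = refl
sumℕ-const c (x ∷ xs) = cong (c ℕ.+_) (sumℕ-const c xs)

length-allFin : ∀ n → length (allFin n) ≡ n
length-allFin n = ListP.length-tabulate id

sumℕ-mono : {B : Set} {f g : B → ℕ} → (∀ x → f x ≤ g x) → ∀ xs → sumℕ f xs ≤ sumℕ g xs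
sumℕ-mono f≤g []       = z≤n
sumℕ-mono f≤g (x ∷ xs) = ℕP.+-mono-≤ (f≤g x) (sumℕ-mono f≤g xs)

sumℕ-zero : {B : Set} (f : B → ℕ) {xs : List B} → sumℕ f xs ≡ 0 → ∀ {x} → x ∈ xs → f x ≡ 0
sumℕ-zero f {y ∷ ys} sum≡0 (here refl) = ℕP.m+n≡0⇒m≡0 (f y) sum≡0
sumℕ-zero f {y ∷ ys} sum≡0 (there x∈ys) = sumℕ-zero f (ℕP.m+n≡0⇒n≡0 (f y) sum≡0) x∈ys

occurs : ∀ {n} → Fin n → List (Fin n) → Bool
occurs z xs = any (λ y → does (z ≟F y)) xs

any-++ : {B : Set} (p : B → Bool) (xs ys : List B) → any p (xs ++ ys) ≡ any p xs ∨ any p ys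
any-++ p []       ys = refl
any-++ p (x ∷ xs) ys = trans (cong (p x ∨_) (any-++ p xs ys)) (sym (BoolP.∨-assoc (p x) _ _))

any-reverse : {B : Set} (p : B → Bool) (xs : List B) → any p (reverse xs) ≡ any p xs
any-reverse p []       = refl
any-reverse p (x ∷ xs) = begin
  any p (reverse (x ∷ xs))            ≡⟨ cong (any p) (ListP.unfold-reverse x xs) ⟩
  any p (reverse xs ++ [ x ])         ≡⟨ any-++ p (reverse xs) [ x ] ⟩
  any p (reverse xs) ∨ (p x ∨ false)  ≡⟨ cong₂ _∨_ (any-reverse p xs) (BoolP.∨-identityʳ (p x)) ⟩
  any p xs ∨ p x                      ≡⟨ BoolP.∨-comm (any p xs) (p x) ⟩
  p x ∨ any p xs                      ∎
  where open ≡-Reasoning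

lastFresh-snoc : ∀ {n} (xs : List (Fin n)) z → lastFresh (xs ∷ʳ z) ≡ not (occurs z xs)
lastFresh-snoc xs z rewrite ListP.reverse-++ xs [ z ] = cong not (any-reverse _ xs)

newEntry : ∀ {n} → Fin n → List (Fin n) → List (Fin n)
newEntry z xs = if occurs z xs then [] else [ z ]

-- Deduplication keeps first occurrences, so appending z appends z to the
-- deduplicated list precisely when z is new.
deduplicate-snoc : ∀ {n} (xs : List (Fin n)) z →
                   deduplicate _≟F_ (xs ∷ʳ z) ≡ deduplicate _≟F_ xs ++ newEntry z xs
deduplicate-snoc []       z = refl
deduplicate-snoc {n} (x ∷ xs) z = cong (x ∷_) (begin
  filter P (deduplicate _≟F_ (xs ∷ʳ z))                       ≡⟨ cong (filter P) (deduplicate-snoc xs z) ⟩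
  filter P (deduplicate _≟F_ xs ++ newEntry z xs)             ≡⟨ ListP.filter-++ P (deduplicate _≟F_ xs) _ ⟩
  filter P (deduplicate _≟F_ xs) ++ filter P (newEntry z xs)  ≡⟨ cong (filter P (deduplicate _≟F_ xs) ++_) filter-new ⟩
  filter P (deduplicate _≟F_ xs) ++ newEntry z (x ∷ xs)       ∎)
  where
  open ≡-Reasoning
  P : (y : Fin n) → Dec (x ≢ y)
  P = λ y → ¬? (x ≟F y)
  filter-new : filter P (newEntry z xs) ≡ newEntry z (x ∷ xs)
  filter-new with occurs z xs
  ... | true  rewrite BoolP.∨-zeroʳ (does (z ≟F x)) = refl
  ... | false with z ≟F x
  ...   | yes refl with x ≟F x
  ...     | yes _  = refl
  ...     | no x≢x = ⊥-elim (x≢x refl)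
  filter-new | false | no z≢x with x ≟F z
  ...     | yes x≡z = ⊥-elim (z≢x (sym x≡z))
  ...     | no _    = refl

card-snoc : ∀ {n} (xs : List (Fin n)) z → card (xs ∷ʳ z) ≡ card xs ℕ.+ 𝟙 (not (occurs z xs))
card-snoc xs z = begin
  card (xs ∷ʳ z)                                       ≡⟨ cong length (deduplicate-snoc xs z) ⟩
  length (deduplicate _≟F_ xs ++ newEntry z xs)        ≡⟨ ListP.length-++ (deduplicate _≟F_ xs) ⟩
  card xs ℕ.+ length (newEntry z xs)                   ≡⟨ cong (card xs ℕ.+_) (new-length (occurs z xs)) ⟩
  card xs ℕ.+ 𝟙 (not (occurs z xs))                    ∎
  where
  open ≡-Reasoning
  new-length : ∀ b → length (if b then [] else [ z ]) ≡ 𝟙 (not b)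
  new-length true  = refl
  new-length false = refl

occurs⇒∈ : ∀ {n} (v : Fin n) xs → occurs v xs ≡ true → v ∈ xs
occurs⇒∈ v (y ∷ ys) occ with v ≟F y
... | yes v≡y = here v≡y
... | no _    = there (occurs⇒∈ v ys occ)

-- a sequence in which every letter occurs has at least n distinct entries:
-- v ↦ (position of v in the deduplicated sequence) is injective
covering⇒n≤card : ∀ {n} (χ : List (Fin n)) → (∀ v → occurs v χ ≡ true) → n ≤ card χ
covering⇒n≤card {n} χ covers = injective⇒≤ {f = position} injective
  where
  v∈ : ∀ v → v ∈ deduplicate _≟F_ χ
  v∈ v = ∈-deduplicate⁺ _≟F_ (occurs⇒∈ v χ (covers v))
  position : Fin n → Fin (card χ)
  position v = Any.index (v∈ v)
  injective : ∀ {v w} → position v ≡ position w → v ≡ w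
  injective {v} {w} eq = trans (lookup-index (v∈ v))
                               (trans (cong (lookup (deduplicate _≟F_ χ)) eq) (sym (lookup-index (v∈ w))))

UnitSteps : (ℕ → ℕ) → Set
UnitSteps g = ∀ t → g (suc t) ≡ g t ⊎ g (suc t) ≡ suc (g t)

module _ {g : ℕ → ℕ} (steps : UnitSteps g) where

  unitSteps-mono : ∀ {t t′} → t ≤ t′ → g t ≤ g t′
  unitSteps-mono {t} {t′} t≤t′ with ℕP.m≤n⇒∃[o]m+o≡n t≤t′
  ... | o , refl = go o
    where
    step : ∀ u → g u ≤ g (suc u)
    step u with steps u
    ... | inj₁ same = ℕP.≤-reflexive (sym same)
    ... | inj₂ up   = subst (g u ≤_) (sym up) (ℕP.n≤1+n (g u))
    go : ∀ o → g t ≤ g (t ℕ.+ o)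
    go zero    = ℕP.≤-reflexive (cong g (sym (ℕP.+-identityʳ t)))
    go (suc o) = ℕP.≤-trans (go o) (subst (λ u → g (t ℕ.+ o) ≤ g u) (sym (ℕP.+-suc t o)) (step (t ℕ.+ o)))

  firstHit : g 0 ≡ 0 → ∀ T i → i ≤ g T → ∃[ s ] s ≤ T × g s ≡ i × (∀ t → t < s → g t < i)
  firstHit g0≡0 zero i i≤g0 =
    0 , z≤n , trans g0≡0 (sym (ℕP.n≤0⇒n≡0 (subst (i ≤_) g0≡0 i≤g0))) , λ t ()
  firstHit g0≡0 (suc T) i i≤gT+1 with i ℕ.≤? g T
  ... | yes i≤gT with firstHit g0≡0 T i i≤gT
  ...   | s , s≤T , gs≡i , below = s , ℕP.m≤n⇒m≤1+n s≤T , gs≡i , below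
  firstHit g0≡0 (suc T) i i≤gT+1 | no i≰gT = suc T , ℕP.≤-refl , hit , below
    where
    gT<i : g T < i
    gT<i = ℕP.≰⇒> i≰gT
    hit : g (suc T) ≡ i
    hit with steps T
    ... | inj₁ same = ⊥-elim (ℕP.<⇒≱ gT<i (subst (i ≤_) same i≤gT+1))
    ... | inj₂ up   = ℕP.≤-antisym (subst (_≤ i) (sym up) gT<i) i≤gT+1
    below : ∀ t → t < suc T → g t < i
    below t (s≤s t≤T) = ℕP.≤-<-trans (unitSteps-mono t≤T) gT<i

takeWhile-length : ∀ (p : ℕ → Bool) (f : ℕ → ℕ) N s → s < N → (∀ t → t < s → p (f t) ≡ true) →
                   p (f s) ≡ false → length (takeWhileᵇ p (applyUpTo f N)) ≡ s
takeWhile-length p f (suc N) zero    _         _      fails rewrite fails = refl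
takeWhile-length p f (suc N) (suc s) (s≤s s<N) before fails rewrite before 0 (s≤s z≤n) =
  cong suc (takeWhile-length p (f ∘ suc) N s s<N (λ t t<s → before (suc t) (s≤s t<s)) fails)

distinctSeen : ∀ {n} → List (Fin n) → ℕ → ℕ
distinctSeen χ t = card (take t χ)

take-suc : {B : Set} (t : ℕ) (χ : List B) → take (suc t) χ ≡ take t χ ⊎ ∃[ e ] take (suc t) χ ≡ take t χ ∷ʳ e
take-suc zero    []      = inj₁ refl
take-suc (suc t) []      = inj₁ refl
take-suc zero    (x ∷ χ) = inj₂ (x , refl)
take-suc (suc t) (x ∷ χ) with take-suc t χ
... | inj₁ eq       = inj₁ (cong (x ∷_) eq)
... | inj₂ (e , eq) = inj₂ (e , cong (x ∷_) eq)

take-prefix : {B : Set} (xs ys : List B) → take (length xs) (xs ++ ys) ≡ xs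
take-prefix []       ys = refl
take-prefix (x ∷ xs) ys = cong (x ∷_) (take-prefix xs ys)

distinctSeen-unitSteps : ∀ {n} (χ : List (Fin n)) → UnitSteps (distinctSeen χ)
distinctSeen-unitSteps χ t with take-suc t χ
... | inj₁ eq       = inj₁ (cong card eq)
... | inj₂ (e , eq) with occurs e (take t χ) | card-snoc (take t χ) e
...   | true  | grow = inj₁ (trans (cong card eq) (trans grow (ℕP.+-identityʳ _)))
...   | false | grow = inj₂ (trans (cong card eq) (trans grow (ℕP.+-comm _ 1)))

tt-first : ∀ {n} i (χ : List (Fin n)) s → s ≤ length χ → (∀ t → t < s → distinctSeen χ t ≢ i) →
           distinctSeen χ s ≡ i → tt i χ ≡ s
tt-first i χ s s≤ℓ before hit = takeWhile-length _ id (suc (length χ)) s (s≤s s≤ℓ)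
  (λ t t<s → cong not (dec-false (card (take t χ) ℕ.≟ i) (before t t<s)))
  (cong not (dec-true (card (take s χ) ℕ.≟ i) hit))

tt-hits : ∀ {n} i (χ : List (Fin n)) → i ≤ card χ → distinctSeen χ (tt i χ) ≡ i
tt-hits i χ i≤card with firstHit (distinctSeen-unitSteps χ) refl (length χ) i
                          (subst (i ≤_) (sym (cong card (ListP.take-all (length χ) χ ℕP.≤-refl))) i≤card)
... | s , s≤ℓ , hit , below =
  trans (cong (distinctSeen χ) (tt-first i χ s s≤ℓ (λ t t<s eq → ℕP.<-irrefl eq (below t t<s)) hit)) hit

tt-increasing : ∀ {n} j (χ : List (Fin n)) → j < card χ → tt j χ < tt (suc j) χ
tt-increasing j χ j<card = ℕP.≰⇒> λ tj+1≤tj → ℕP.<-irrefl refl (begin-strict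
  j                           <⟨ ℕP.n<1+n j ⟩
  suc j                       ≡⟨ sym (tt-hits (suc j) χ j<card) ⟩
  distinctSeen χ (tt (suc j) χ) ≤⟨ unitSteps-mono (distinctSeen-unitSteps χ) tj+1≤tj ⟩
  distinctSeen χ (tt j χ)     ≡⟨ tt-hits j χ (ℕP.<⇒≤ j<card) ⟩
  j                           ∎)
  where open ℕP.≤-Reasoning

telescope : ∀ (t : ℕ → ℕ) K → (∀ j → 1 ≤ j → j ≤ K → t j < t (suc j)) →
            K ℕ.+ t 1 ℕ.+ sumℕ (λ i → t (suc (suc i)) ∸ t (suc i) ∸ 1) (upTo K) ≡ t (suc K)
telescope t zero    _   = ℕP.+-identityʳ (t 1)
telescope t (suc K) inc = begin
  suc K ℕ.+ t 1 ℕ.+ sumℕ gap (upTo (suc K))        ≡⟨ cong (suc K ℕ.+ t 1 ℕ.+_) (ℕΣ.sumOf-upTo-suc gap K) ⟩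
  suc K ℕ.+ t 1 ℕ.+ (sumℕ gap (upTo K) ℕ.+ gap K)  ≡⟨ regroup (K ℕ.+ t 1) (sumℕ gap (upTo K)) (gap K) ⟩
  (K ℕ.+ t 1 ℕ.+ sumℕ gap (upTo K)) ℕ.+ suc (gap K) ≡⟨ cong (ℕ._+ suc (gap K)) (telescope t K (λ j 1≤j j≤K → inc j 1≤j (ℕP.m≤n⇒m≤1+n j≤K))) ⟩
  t (suc K) ℕ.+ suc (gap K)                         ≡⟨ close (inc (suc K) (s≤s z≤n) ℕP.≤-refl) ⟩
  t (suc (suc K))                                   ∎
  where
  open ≡-Reasoning
  gap : ℕ → ℕ
  gap i = t (suc (suc i)) ∸ t (suc i) ∸ 1
  regroup : ∀ a b c → suc a ℕ.+ (b ℕ.+ c) ≡ (a ℕ.+ b) ℕ.+ suc c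
  regroup a b c = trans (cong suc (sym (ℕP.+-assoc a b c))) (sym (ℕP.+-suc (a ℕ.+ b) c))
  close : ∀ {a b} → a < b → a ℕ.+ suc (b ∸ a ∸ 1) ≡ b
  close {a} {b} a<b = begin
    a ℕ.+ suc (b ∸ a ∸ 1)   ≡⟨ ℕP.+-suc a _ ⟩
    suc a ℕ.+ (b ∸ a ∸ 1)   ≡⟨ cong (suc a ℕ.+_) (trans (ℕP.∸-+-assoc b a 1) (cong (b ∸_) (ℕP.+-comm a 1))) ⟩
    suc a ℕ.+ (b ∸ suc a)   ≡⟨ ℕP.m+[n∸m]≡n a<b ⟩
    b                       ∎

inX-parts : ∀ {n} m (χ : List (Fin n)) → T (inX m χ) → card χ ≡ m × T (lastFresh χ)
inX-parts m χ χ∈𝒳 with Equivalence.to (BoolP.T-∧ {does (card χ ℕ.≟ m)} {lastFresh χ}) χ∈𝒳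
... | card≡ , fresh = ℕP.≡ᵇ⇒≡ (card χ) m card≡ , fresh

-- Key identity: every χ ∈ 𝒳_m satisfies  m + Σ_{j=1}^{m-1} τ_j(χ) = ℓ(χ).
-- Writing χ = ψ ∷ʳ z with z new, t₁ = 1 and t_m = ℓ(χ), so this is telescoping.
τ-sum : ∀ {n} M (χ : List (Fin n)) → T (inX (suc M) χ) →
        suc M ℕ.+ sumℕ (λ i → τ (suc i) χ) (upTo M) ≡ length χ
τ-sum {n} M χ χ∈𝒳 with initLast χ | inX-parts (suc M) χ χ∈𝒳
... | []      | _ , ()
... | ψ ∷ʳ′ z | cardχ , fresh = begin
  suc M ℕ.+ sumℕ (λ i → τ (suc i) χ′) (upTo M)  ≡⟨ cong (λ x → x ℕ.+ sumℕ (λ i → τ (suc i) χ′) (upTo M))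
                                                        (trans (ℕP.+-comm 1 M) (cong (M ℕ.+_) (sym t₁≡1))) ⟩
  M ℕ.+ t 1 ℕ.+ sumℕ (λ i → τ (suc i) χ′) (upTo M) ≡⟨ telescope t M (λ j _ j≤M → tt-increasing j χ′ (subst (j <_) (sym cardχ) (s≤s j≤M))) ⟩
  t (suc M)                                     ≡⟨ tₘ≡ℓ ⟩
  length χ′                                      ∎
  where
  open ≡-Reasoning
  χ′ : List (Fin n)
  χ′ = ψ ∷ʳ z
  t : ℕ → ℕ
  t j = tt j χ′
  z-new : occurs z ψ ≡ false
  z-new = Equivalence.to BoolP.T-not-≡ (subst T (lastFresh-snoc ψ z) fresh)
  cardψ : card ψ ≡ M
  cardψ = ℕP.suc-injective (trans (trans (ℕP.+-comm 1 (card ψ)) (cong (λ b → card ψ ℕ.+ 𝟙 (not b)) (sym z-new)))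
                                   (trans (sym (card-snoc ψ z)) cardχ))
  ℓχ : length χ′ ≡ suc (length ψ)
  ℓχ = trans (ListP.length-++ ψ) (ℕP.+-comm (length ψ) 1)
  t₁≡1 : t 1 ≡ 1
  t₁≡1 = tt-first 1 χ′ 1 (subst (1 ≤_) (sym ℓχ) (s≤s z≤n)) (λ { zero _ () ; (suc _) (s≤s ()) }) (first-entry ψ)
    where
    first-entry : ∀ ψ → distinctSeen (ψ ∷ʳ z) 1 ≡ 1
    first-entry []      = refl
    first-entry (_ ∷ _) = refl
  tₘ≡ℓ : t (suc M) ≡ length χ′
  tₘ≡ℓ = tt-first (suc M) χ′ (length χ′) ℕP.≤-refl before
           (trans (cong card (ListP.take-all (length χ′) χ′ ℕP.≤-refl)) cardχ)
    where
    -- before the last position only the M entries of ψ have been seen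
    before : ∀ u → u < length χ′ → distinctSeen χ′ u ≢ suc M
    before u u<ℓ seen = ℕP.1+n≰n (subst (_≤ M) seen (ℕP.≤-trans
      (unitSteps-mono (distinctSeen-unitSteps χ′) (ℕP.≤-pred (subst (u <_) ℓχ u<ℓ)))
      (ℕP.≤-reflexive (trans (cong card (take-prefix ψ [ z ])) cardψ))))

unit-weights : ∀ k (P : ℚ) a (b : ℕ → ℕ) (is : List ℕ) → a ℕ.+ sumℕ b is ≡ suc k →
               ι a ℚ.* (((+ 1) / suc k) ℚ.* P) ℚ.+ sumQ (λ i → ((+ b i) / suc k) ℚ.* P) is ≡ P
unit-weights k P a b is a+Σb≡ℓ = begin
  ι a ℚ.* w ℚ.+ sumQ (λ i → ((+ b i) / suc k) ℚ.* P) is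
    ≡⟨ cong (ι a ℚ.* w ℚ.+_) (ℚΣ.sumOf-cong split is) ⟩
  ι a ℚ.* w ℚ.+ sumQ (λ i → ι (b i) ℚ.* w) is
    ≡⟨ cong (ι a ℚ.* w ℚ.+_) (trans (sym (ℚΣ.sumOf-*ʳ w (ι ∘ b) is)) (cong (ℚ._* w) (ι-sum b is))) ⟩
  ι a ℚ.* w ℚ.+ ι (sumℕ b is) ℚ.* w
    ≡⟨ sym (ℚP.*-distribʳ-+ w (ι a) (ι (sumℕ b is))) ⟩
  (ι a ℚ.+ ι (sumℕ b is)) ℚ.* w
    ≡⟨ cong (ℚ._* w) (trans (sym (ι-+ a (sumℕ b is))) (cong ι a+Σb≡ℓ)) ⟩
  ι (suc k) ℚ.* (((+ 1) / suc k) ℚ.* P)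
    ≡⟨ sym (ℚP.*-assoc (ι (suc k)) ((+ 1) / suc k) P) ⟩
  (ι (suc k) ℚ.* ((+ 1) / suc k)) ℚ.* P
    ≡⟨ cong (ℚ._* P) (trans (ℚP.*-comm (ι (suc k)) _) (/-inverse (suc k))) ⟩
  1ℚ ℚ.* P
    ≡⟨ ℚP.*-identityˡ P ⟩
  P ∎
  where
  open ≡-Reasoning
  w : ℚ
  w = ((+ 1) / suc k) ℚ.* P
  split : ∀ i → ((+ b i) / suc k) ℚ.* P ≡ ι (b i) ℚ.* w
  split i = trans (cong (ℚ._* P) (/-split (b i) (suc k))) (ℚP.*-assoc (ι (b i)) ((+ 1) / suc k) P)

count𝒳 : ℕ → ℕ → ℕ → ℕ
count𝒳 n m ℓ = length (filterᵇ (inX m) (seqs n ℓ))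

seqs-length : ∀ n ℓ → All (λ χ → length χ ≡ ℓ) (seqs n ℓ)
seqs-length n zero    = refl ∷ []
seqs-length n (suc ℓ) =
  AllP.concat⁺ (AllP.map⁺ (AllP.tabulate⁺ {f = id} λ x → AllP.map⁺ {f = x ∷_} (All.map (cong suc) (seqs-length n ℓ))))

level-identity : ∀ n M ℓ → ι (suc M) ℚ.* levelE n (suc M) (λ _ → 1) ℓ ℚ.+ sumQ (λ i → levelE n (suc M) (τ (suc i)) ℓ) (upTo M)
                           ≡ ι (count𝒳 n (suc M) ℓ) ℚ.* invPow n ℓ
level-identity n M zero = begin
  ι (suc M) ℚ.* 0ℚ ℚ.+ sumQ (λ _ → 0ℚ) (upTo M) ≡⟨ cong₂ ℚ._+_ (ℚP.*-zeroʳ (ι (suc M))) (ℚΣ.sumOf-zero (upTo M)) ⟩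
  0ℚ                                          ≡⟨ sym (ℚP.*-zeroˡ (invPow n 0)) ⟩
  0ℚ ℚ.* invPow n 0                           ∎
  where open ≡-Reasoning
level-identity n M (suc k) = begin
  ι m ℚ.* sumQ (λ _ → r ℚ.* P) F ℚ.+ sumQ (λ i → sumQ (λ χ → w i χ) F) (upTo M)
    ≡⟨ cong₂ ℚ._+_ (ℚΣ.sumOf-*ˡ (ι m) (λ _ → r ℚ.* P) F) (ℚΣ.sumOf-swap w (upTo M) F) ⟩
  sumQ (λ _ → ι m ℚ.* (r ℚ.* P)) F ℚ.+ sumQ (λ χ → sumQ (λ i → w i χ) (upTo M)) F
    ≡⟨ sym (ℚΣ.sumOf-+ _ _ F) ⟩
  sumQ (λ χ → ι m ℚ.* (r ℚ.* P) ℚ.+ sumQ (λ i → w i χ) (upTo M)) F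
    ≡⟨ ℚΣ.sumOf-congAll (λ {χ} (χ∈𝒳 , ℓχ) → unit-weights k P m (λ i → τ (suc i) χ) (upTo M) (trans (τ-sum M χ χ∈𝒳) ℓχ))
                        (All.zip (AllP.all-filter (T? ∘ inX m) (seqs n (suc k)) , AllP.filter⁺ (T? ∘ inX m) (seqs-length n (suc k)))) ⟩
  sumQ (λ _ → P) F
    ≡⟨ sumQ-const P F ⟩
  ι (length F) ℚ.* P ∎
  where
  open ≡-Reasoning
  m : ℕ
  m = suc M
  P : ℚ
  P = invPow n (suc k)
  r : ℚ
  r = (+ 1) / suc k
  F : List (List (Fin n))
  F = filterᵇ (inX m) (seqs n (suc k))
  w : ℕ → List (Fin n) → ℚ
  w i χ = ((+ τ (suc i) χ) / suc k) ℚ.* P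

lhs-as-mass : ∀ n M L → lhsPartial n (suc M) L ≡ sumQ (λ ℓ → ι (count𝒳 n (suc M) ℓ) ℚ.* invPow n ℓ) (upTo (suc L))
lhs-as-mass n M L = begin
  ι m ℚ.* sumQ (level (λ _ → 1)) U ℚ.+ sumQ (λ i → sumQ (level (τ (suc i))) U) (upTo M)
    ≡⟨ cong₂ ℚ._+_ (ℚΣ.sumOf-*ˡ (ι m) (level (λ _ → 1)) U) (ℚΣ.sumOf-swap (λ i → level (τ (suc i))) (upTo M) U) ⟩
  sumQ (λ ℓ → ι m ℚ.* level (λ _ → 1) ℓ) U ℚ.+ sumQ (λ ℓ → sumQ (λ i → level (τ (suc i)) ℓ) (upTo M)) U
    ≡⟨ sym (ℚΣ.sumOf-+ (λ ℓ → ι m ℚ.* level (λ _ → 1) ℓ) (λ ℓ → sumQ (λ i → level (τ (suc i)) ℓ) (upTo M)) U) ⟩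
  sumQ (λ ℓ → ι m ℚ.* level (λ _ → 1) ℓ ℚ.+ sumQ (λ i → level (τ (suc i)) ℓ) (upTo M)) U
    ≡⟨ ℚΣ.sumOf-cong (level-identity n M) U ⟩
  sumQ (λ ℓ → ι (count𝒳 n m ℓ) ℚ.* invPow n ℓ) U ∎
  where
  open ≡-Reasoning
  m : ℕ
  m = suc M
  U : List ℕ
  U = upTo (suc L)
  level : (List (Fin n) → ℕ) → ℕ → ℚ
  level = levelE n m

countBelow : ℕ → ℕ → ℕ → ℕ
countBelow n m L = length (filterᵇ (λ χ → card χ <ᵇ m) (seqs n L))

below-step : ∀ c m → 𝟙 (suc c <ᵇ m) ℕ.+ 𝟙 (does (suc c ℕ.≟ m)) ≡ 𝟙 (c <ᵇ m)
below-step c       zero          = refl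
below-step zero    (suc zero)    = refl
below-step zero    (suc (suc m)) = refl
below-step (suc c) (suc m)       = below-step c m

below-or-new : ∀ {n} m (χ : List (Fin n)) z →
               𝟙 (card (χ ∷ʳ z) <ᵇ m) ℕ.+ 𝟙 (inX m (χ ∷ʳ z)) ≡ 𝟙 (card χ <ᵇ m)
below-or-new m χ z rewrite card-snoc χ z | lastFresh-snoc χ z with occurs z χ
... | true  rewrite BoolP.∧-zeroʳ (does (card χ ℕ.+ 0 ℕ.≟ m)) | ℕP.+-identityʳ (card χ) = ℕP.+-identityʳ _
... | false rewrite BoolP.∧-identityʳ (does (card χ ℕ.+ 1 ℕ.≟ m)) | ℕP.+-comm (card χ) 1 = below-step (card χ) m

count-recursion : ∀ n m L → countBelow n m (suc L) ℕ.+ count𝒳 n m (suc L) ≡ n ℕ.* countBelow n m L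
count-recursion n m L = begin
  countBelow n m (suc L) ℕ.+ count𝒳 n m (suc L)
    ≡⟨ cong₂ ℕ._+_ (count-filter below (seqs n (suc L))) (count-filter (inX m) (seqs n (suc L))) ⟩
  sumℕ (𝟙 ∘ below) (seqs n (suc L)) ℕ.+ sumℕ (𝟙 ∘ inX m) (seqs n (suc L))
    ≡⟨ sym (ℕΣ.sumOf-+ (𝟙 ∘ below) (𝟙 ∘ inX m) (seqs n (suc L))) ⟩
  sumℕ (λ χ → 𝟙 (below χ) ℕ.+ 𝟙 (inX m χ)) (seqs n (suc L))
    ≡⟨ ℕΣ.sumOf-seqs-snoc L _ ⟩
  sumℕ (λ ψ → sumℕ (λ z → 𝟙 (below (ψ ∷ʳ z)) ℕ.+ 𝟙 (inX m (ψ ∷ʳ z))) (allFin n)) (seqs n L)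
    ≡⟨ ℕΣ.sumOf-cong (λ ψ → ℕΣ.sumOf-cong (below-or-new m ψ) (allFin n)) (seqs n L) ⟩
  sumℕ (λ ψ → sumℕ (λ _ → 𝟙 (below ψ)) (allFin n)) (seqs n L)
    ≡⟨ ℕΣ.sumOf-cong (λ ψ → trans (sumℕ-const _ (allFin n)) (cong (ℕ._* 𝟙 (below ψ)) (length-allFin n))) (seqs n L) ⟩
  sumℕ (λ ψ → n ℕ.* 𝟙 (below ψ)) (seqs n L)
    ≡⟨ sym (ℕΣ.sumOf-*ˡ n (𝟙 ∘ below) (seqs n L)) ⟩
  n ℕ.* sumℕ (𝟙 ∘ below) (seqs n L)
    ≡⟨ cong (n ℕ.*_) (sym (count-filter below (seqs n L))) ⟩
  n ℕ.* countBelow n m L ∎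
  where
  open ≡-Reasoning
  below : List (Fin n) → Bool
  below χ = card χ <ᵇ m

invPow-step : ∀ a L → invPow (suc a) L ≡ ι (suc a) ℚ.* invPow (suc a) (suc L)
invPow-step a L = begin
  x                            ≡⟨ sym (ℚP.*-identityʳ x) ⟩
  x ℚ.* 1ℚ                     ≡⟨ cong (x ℚ.*_) (sym y·nk≡1) ⟩
  x ℚ.* (y ℚ.* (u ℚ.* w))      ≡⟨ solve 4 (λ x y u w → x :* (y :* (u :* w)) := (x :* w) :* (u :* y)) refl x y u w ⟩
  (x ℚ.* w) ℚ.* (u ℚ.* y)      ≡⟨ cong (ℚ._* (u ℚ.* y)) (/-inverse k {{ℕP.m^n≢0 n L}}) ⟩
  1ℚ ℚ.* (u ℚ.* y)             ≡⟨ ℚP.*-identityˡ (u ℚ.* y) ⟩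
  u ℚ.* y                      ∎
  where
  open ≡-Reasoning
  open +-*-Solver using (solve; _:*_; _:=_)
  n : ℕ
  n = suc a
  k : ℕ
  k = n ^ L
  x : ℚ
  x = invPow n L
  y : ℚ
  y = invPow n (suc L)
  u : ℚ
  u = ι n
  w : ℚ
  w = ι k
  y·nk≡1 : y ℚ.* (u ℚ.* w) ≡ 1ℚ
  y·nk≡1 = trans (cong (y ℚ.*_) (sym (ι-* n k))) (/-inverse (n ^ suc L) {{ℕP.m^n≢0 n (suc L)}})

mass-identity : ∀ a M L →
  sumQ (λ ℓ → ι (count𝒳 (suc a) (suc M) ℓ) ℚ.* invPow (suc a) ℓ) (upTo (suc L))
    ℚ.+ ι (countBelow (suc a) (suc M) L) ℚ.* invPow (suc a) L ≡ 1ℚ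
mass-identity a M zero    = refl   -- c₀ = 0 and B₀ = 1: both sides evaluate to 1
mass-identity a M (suc L) = begin
  sumQ mass (upTo (suc (suc L))) ℚ.+ ι B′ ℚ.* P′
    ≡⟨ cong (ℚ._+ ι B′ ℚ.* P′) (ℚΣ.sumOf-upTo-suc mass (suc L)) ⟩
  (S ℚ.+ ι c ℚ.* P′) ℚ.+ ι B′ ℚ.* P′
    ≡⟨ solve 4 (λ s c b p → (s :+ c :* p) :+ b :* p := s :+ (b :+ c) :* p) refl S (ι c) (ι B′) P′ ⟩
  S ℚ.+ (ι B′ ℚ.+ ι c) ℚ.* P′
    ≡⟨ cong (λ x → S ℚ.+ x ℚ.* P′) (trans (sym (ι-+ B′ c)) (trans (cong ι (count-recursion n m L)) (ι-* n B))) ⟩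
  S ℚ.+ (ι n ℚ.* ι B) ℚ.* P′
    ≡⟨ cong (S ℚ.+_) (solve 3 (λ u b p → (u :* b) :* p := b :* (u :* p)) refl (ι n) (ι B) P′) ⟩
  S ℚ.+ ι B ℚ.* (ι n ℚ.* P′)
    ≡⟨ cong (λ x → S ℚ.+ ι B ℚ.* x) (sym (invPow-step a L)) ⟩
  S ℚ.+ ι B ℚ.* invPow n L
    ≡⟨ mass-identity a M L ⟩
  1ℚ ∎
  where
  open ≡-Reasoning
  open +-*-Solver using (solve; _:+_; _:*_; _:=_)
  n : ℕ
  n = suc a
  m : ℕ
  m = suc M
  mass : ℕ → ℚ
  mass ℓ = ι (count𝒳 n m ℓ) ℚ.* invPow n ℓ
  S : ℚ
  S = sumQ mass (upTo (suc L))
  B : ℕ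
  B = countBelow n m L
  B′ : ℕ
  B′ = countBelow n m (suc L)
  c : ℕ
  c = count𝒳 n m (suc L)
  P′ : ℚ
  P′ = invPow n (suc L)

𝟙-not-∨ : ∀ b c → 𝟙 (not (b ∨ c)) ≡ 𝟙 (not b) ℕ.* 𝟙 (not c)
𝟙-not-∨ true  c     = refl
𝟙-not-∨ false true  = refl
𝟙-not-∨ false false = refl

others : ∀ a (v : Fin (suc a)) → sumℕ (λ x → 𝟙 (not (does (v ≟F x)))) (allFin (suc a)) ≡ a
others a v = trans (ℕΣ.sumOf-allFin-suc (λ x → 𝟙 (not (does (v ≟F x))))) (go a v)
  where
  go : ∀ a (v : Fin (suc a)) → 𝟙 (not (does (v ≟F zero))) ℕ.+ sumℕ (λ x → 𝟙 (not (does (v ≟F suc x)))) (allFin a) ≡ a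
  go a       zero    = trans (sumℕ-const 1 (allFin a)) (trans (ℕP.*-identityʳ _) (length-allFin a))
  go (suc a) (suc w) = cong suc (others a w)

avoiding : ∀ a (v : Fin (suc a)) L → sumℕ (λ χ → 𝟙 (not (occurs v χ))) (seqs (suc a) L) ≡ a ^ L
avoiding a v zero    = refl
avoiding a v (suc L) = begin
  sumℕ avoids (seqs n (suc L))
    ≡⟨ ℕΣ.sumOf-seqs-cons L avoids ⟩
  sumℕ (λ x → sumℕ (λ χ → 𝟙 (not (does (v ≟F x) ∨ occurs v χ))) (seqs n L)) (allFin n)
    ≡⟨ ℕΣ.sumOf-cong (λ x → trans (ℕΣ.sumOf-cong (λ χ → 𝟙-not-∨ (does (v ≟F x)) (occurs v χ)) (seqs n L))
                                  (sym (ℕΣ.sumOf-*ˡ (other x) avoids (seqs n L)))) (allFin n) ⟩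
  sumℕ (λ x → other x ℕ.* sumℕ avoids (seqs n L)) (allFin n)
    ≡⟨ sym (ℕΣ.sumOf-*ʳ (sumℕ avoids (seqs n L)) other (allFin n)) ⟩
  sumℕ other (allFin n) ℕ.* sumℕ avoids (seqs n L)
    ≡⟨ cong₂ ℕ._*_ (others a v) (avoiding a v L) ⟩
  a ℕ.* a ^ L ∎
  where
  open ≡-Reasoning
  n : ℕ
  n = suc a
  avoids : List (Fin n) → ℕ
  avoids χ = 𝟙 (not (occurs v χ))
  other : Fin n → ℕ
  other x = 𝟙 (not (does (v ≟F x)))

-- union bound: a sequence with fewer than m ≤ n distinct entries misses some letter
below⇒misses : ∀ {n} m → m ≤ n → (χ : List (Fin n)) →
               𝟙 (card χ <ᵇ m) ≤ sumℕ (λ v → 𝟙 (not (occurs v χ))) (allFin n)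
below⇒misses {n} m m≤n χ with card χ <ᵇ m in below
... | false = z≤n
... | true with sumℕ (λ v → 𝟙 (not (occurs v χ))) (allFin n) in misses
...   | suc _ = s≤s z≤n
...   | zero  = ⊥-elim (ℕP.<⇒≱ (ℕP.<-≤-trans card<m m≤n) (covering⇒n≤card χ covers))
  where
  card<m : card χ < m
  card<m = ℕP.<ᵇ⇒< (card χ) m (subst T (sym below) _)
  occurs-if-not-missing : ∀ b → 𝟙 (not b) ≡ 0 → b ≡ true
  occurs-if-not-missing true _ = refl
  covers : ∀ v → occurs v χ ≡ true
  covers v = occurs-if-not-missing (occurs v χ) (sumℕ-zero (λ v → 𝟙 (not (occurs v χ))) misses (∈-allFin v))

countBelow-bound : ∀ a m → m ≤ suc a → ∀ L → countBelow (suc a) m L ≤ suc a ℕ.* a ^ L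
countBelow-bound a m m≤n L = begin
  countBelow n m L                                                   ≡⟨ count-filter _ (seqs n L) ⟩
  sumℕ (λ χ → 𝟙 (card χ <ᵇ m)) (seqs n L)                            ≤⟨ sumℕ-mono (below⇒misses m m≤n) (seqs n L) ⟩
  sumℕ (λ χ → sumℕ (λ v → 𝟙 (not (occurs v χ))) (allFin n)) (seqs n L) ≡⟨ ℕΣ.sumOf-swap _ (seqs n L) (allFin n) ⟩
  sumℕ (λ v → sumℕ (λ χ → 𝟙 (not (occurs v χ))) (seqs n L)) (allFin n) ≡⟨ ℕΣ.sumOf-cong (λ v → avoiding a v L) (allFin n) ⟩
  sumℕ (λ _ → a ^ L) (allFin n)                                      ≡⟨ sumℕ-const (a ^ L) (allFin n) ⟩
  length (allFin n) ℕ.* a ^ L                                        ≡⟨ cong (ℕ._* a ^ L) (length-allFin n) ⟩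
  n ℕ.* a ^ L                                                        ∎
  where
  open ℕP.≤-Reasoning
  n : ℕ
  n = suc a

remainder : ∀ a M L → 1ℚ - lhsPartial (suc a) (suc M) L ≡ ((+ countBelow (suc a) (suc M) L) / (suc a ^ L)) {{ℕP.m^n≢0 (suc a) L}}
remainder a M L = begin
  1ℚ - lhsPartial n m L ≡⟨ cong₂ _-_ (sym (mass-identity a M L)) (lhs-as-mass n M L) ⟩
  (S ℚ.+ y) - S         ≡⟨ solve 2 (λ s y → (s :+ y) :- s := y) refl S y ⟩
  y                     ≡⟨ sym (/-split B (n ^ L) {{ℕP.m^n≢0 n L}}) ⟩
  (+ B) / (n ^ L)       ∎
  where
  open ≡-Reasoning
  open +-*-Solver using (solve; _:+_; _:-_; _:=_)
  n : ℕ
  n = suc a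
  m : ℕ
  m = suc M
  instance
    nᴸ≢0 : ℕ.NonZero (n ^ L)
    nᴸ≢0 = ℕP.m^n≢0 n L
  S : ℚ
  S = sumQ (λ ℓ → ι (count𝒳 n m ℓ) ℚ.* invPow n ℓ) (upTo (suc L))
  B : ℕ
  B = countBelow n m L
  y : ℚ
  y = ι B ℚ.* invPow n L

bernoulli : ∀ a L → a ^ L ℕ.* (a ℕ.+ L) ≤ a ℕ.* suc a ^ L
bernoulli a zero    = ℕP.≤-reflexive (trans (ℕP.*-identityˡ (a ℕ.+ 0)) (trans (ℕP.+-identityʳ a) (sym (ℕP.*-identityʳ a))))
bernoulli a (suc L) = begin
  a ^ suc L ℕ.* (a ℕ.+ suc L)                  ≡⟨ solve 3 (λ a x L → (a :* x) :* (a :+ (con 1 :+ L)) := x :* (a :+ L) :* a :+ a :* x) refl a x L ⟩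
  x ℕ.* (a ℕ.+ L) ℕ.* a ℕ.+ a ℕ.* x            ≤⟨ ℕP.+-monoʳ-≤ (x ℕ.* (a ℕ.+ L) ℕ.* a) (ℕP.≤-trans (ℕP.≤-reflexive (ℕP.*-comm a x)) (ℕP.*-monoʳ-≤ x (ℕP.m≤m+n a L))) ⟩
  x ℕ.* (a ℕ.+ L) ℕ.* a ℕ.+ x ℕ.* (a ℕ.+ L)    ≡⟨ solve 3 (λ a x L → x :* (a :+ L) :* a :+ x :* (a :+ L) := x :* (a :+ L) :* (con 1 :+ a)) refl a x L ⟩
  x ℕ.* (a ℕ.+ L) ℕ.* suc a                    ≤⟨ ℕP.*-monoˡ-≤ (suc a) (bernoulli a L) ⟩
  a ℕ.* suc a ^ L ℕ.* suc a                    ≡⟨ solve 2 (λ a y → a :* y :* (con 1 :+ a) := a :* ((con 1 :+ a) :* y)) refl a (suc a ^ L) ⟩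
  a ℕ.* suc a ^ suc L                          ∎
  where
  open ℕP.≤-Reasoning
  open ℕSolver.+-*-Solver using (solve; _:+_; _:*_; _:=_; con)
  x : ℕ
  x = a ^ L

-- with B ≤ n (n-1)^L, the ratio B/n^L falls below 1/Q once L > n² Q:
--   n² B Q < B L ≤ n (n-1)^L (n-1+L) ≤ n (n-1) n^L ≤ n² n^L
tail-bound : ∀ a B Q L → B ≤ suc a ℕ.* a ^ L → suc a ℕ.* suc a ℕ.* Q < L → B ℕ.* Q < suc a ^ L
tail-bound a zero      Q L _   _    = ℕP.m^n>0 (suc a) L
tail-bound a B@(suc _) Q L B≤ L-big = ℕP.*-cancelˡ-< nn (B ℕ.* Q) k (begin-strict
  nn ℕ.* (B ℕ.* Q)                 ≡⟨ solve 3 (λ n B Q → n :* (B :* Q) := B :* (n :* Q)) refl nn B Q ⟩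
  B ℕ.* (nn ℕ.* Q)                 <⟨ ℕP.*-monoʳ-< B L-big ⟩
  B ℕ.* L                          ≤⟨ ℕP.*-monoʳ-≤ B (ℕP.m≤n+m L a) ⟩
  B ℕ.* (a ℕ.+ L)                  ≤⟨ ℕP.*-monoˡ-≤ (a ℕ.+ L) B≤ ⟩
  suc a ℕ.* a ^ L ℕ.* (a ℕ.+ L)    ≡⟨ ℕP.*-assoc (suc a) (a ^ L) (a ℕ.+ L) ⟩
  suc a ℕ.* (a ^ L ℕ.* (a ℕ.+ L))  ≤⟨ ℕP.*-monoʳ-≤ (suc a) (bernoulli a L) ⟩
  suc a ℕ.* (a ℕ.* k)              ≤⟨ ℕP.*-monoʳ-≤ (suc a) (ℕP.*-monoˡ-≤ k (ℕP.n≤1+n a)) ⟩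
  suc a ℕ.* (suc a ℕ.* k)          ≡⟨ sym (ℕP.*-assoc (suc a) (suc a) k) ⟩
  nn ℕ.* k                         ∎)
  where
  open ℕP.≤-Reasoning
  open ℕSolver.+-*-Solver using (solve; _:*_; _:=_)
  nn : ℕ
  nn = suc a ℕ.* suc a
  k : ℕ
  k = suc a ^ L

/-<-positive : ∀ B k .{{_ : ℕ.NonZero k}} p q-1 .(c : Coprime (suc p) (suc q-1)) → B ℕ.* suc q-1 < suc p ℕ.* k →
               (+ B) / k ℚ.< mkℚ +[1+ p ] q-1 c
/-<-positive B k@(suc k-1) p q-1 c B·q<p·k =
  ℚP.toℚᵘ-cancel-< (ℚᵘP.<-respˡ-≃ (ℚᵘP.≃-sym (toℚᵘ-/ B k)) (ℚᵘ.*<* integers))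
  where
  integers : (+ B) ℤ.* (+ suc q-1) ℤ.< +[1+ p ] ℤ.* (+ k)
  integers = subst₂ ℤ._<_ (ℤP.pos-* B (suc q-1)) (ℤP.pos-* (suc p) k) (ℤ.+<+ B·q<p·k)

lemma2p12 : ∀ (n m : ℕ) → 1 ≤ m → m ≤ n →
    ∀ (ε : ℚ) → 0ℚ ℚ.< ε → ∃[ L₀ ] ∀ (L : ℕ) → L₀ ≤ L → ∣ 1ℚ - lhsPartial n m L ∣ ℚ.< ε
lemma2p12 zero    (suc M) _ () _ _
lemma2p12 (suc a) (suc M) _ _ (mkℚ (+ zero)   _ _) (ℚ.*<* (ℤ.+<+ ()))
lemma2p12 (suc a) (suc M) _ _ (mkℚ -[1+ _ ]   _ _) (ℚ.*<* ())
lemma2p12 (suc a) (suc M) _ m≤n ε@(mkℚ +[1+ p ] q-1 c) _ = suc (n ℕ.* n ℕ.* suc q-1) , small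
  where
  n : ℕ
  n = suc a
  small : ∀ L → suc (n ℕ.* n ℕ.* suc q-1) ≤ L → ∣ 1ℚ - lhsPartial n (suc M) L ∣ ℚ.< ε
  small L L-big = begin-strict
    ∣ 1ℚ - lhsPartial n (suc M) L ∣  ≡⟨ cong ∣_∣ (remainder a M L) ⟩
    ∣ (+ B) / (n ^ L) ∣              ≡⟨ ℚP.0≤p⇒∣p∣≡p (ℚP.nonNegative⁻¹ _ {{ℚP.normalize-nonNeg B (n ^ L)}}) ⟩
    (+ B) / (n ^ L)                  <⟨ /-<-positive B (n ^ L) p q-1 c B·q<p·nᴸ ⟩
    ε                                ∎
    where
    open ℚP.≤-Reasoning
    instance
      nᴸ≢0 : ℕ.NonZero (n ^ L)
      nᴸ≢0 = ℕP.m^n≢0 n L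
    B : ℕ
    B = countBelow n (suc M) L
    B·q<p·nᴸ : B ℕ.* suc q-1 < suc p ℕ.* n ^ L
    B·q<p·nᴸ = ℕP.<-≤-trans (tail-bound a B (suc q-1) L (countBelow-bound a (suc M) m≤n L) L-big)
                            (ℕP.m≤n*m (n ^ L) (suc p))
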